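{- Let $\vec x\in\Delta^k$ be a $k$-cut lying in a base simplex of the triangulation with corners $\vec x^{(0)},\dots,\vec x^{(k)}\in\Delta^k_n$. If $|\{P(\vec x^{(0)}),\dots,P(\vec x^{(k)})\}|\le2$, then $\vec x$ is not an $\epsilon$-approximate $3$-out-of-$(k+1)$ envy-free cut whenever $\epsilon\le1/(10N)$.
   Context: $\Delta^k=\{\vec x\in[0,1]^{k+1}:\sum x_i=1\}$, $\Delta^k_n=\{\vec x\in\Delta^k:(2^n-1)x_i\in\mathbb Z\}$, $N=2^n-1$; points of $\Delta^k$ are identified with $k$-cuts of the cake $[0,1]$, each inducing pieces $X_0,\dots,X_k$. Fix a triangulation of $\Delta^k$ into base simplices whose vertices are the points of $\Delta^k_n$; every $\vec x$ in a base simplex is a unique convex combination $\vec x=\sum_i\alpha_i\vec x^{(i)}$ of its corners. A preference (coloring) $P:\Delta^k_n\to\{0,\dots,k\}$ is given. All $k+1$ agents share the same utility, defined as follows: for $\vec x\in\Delta^k_n$, $u(\vec x,X_{P(\vec x)})=1/(2N)$, $u(\vec x,X_j)=0$ if $X_j$ is empty, and $u(\vec x,X_j)=1/(10k^2N)$ for every other piece; for general $\vec x=\sum_i\alpha_i\vec x^{(i)}$ in a base simplex, $u(\vec x,X_j)=\sum_i\alpha_i u(\vec x^{(i)},X^{(i)}_j)$, where $X^{(i)}_j$ is the $j$-th piece of $\vec x^{(i)}$. A $k$-cut $\vec x$ is an $\epsilon$-approximate $3$-out-of-$(k+1)$ envy-free cut if there are a permutation $\pi$ assigning one piece to each agent and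 a set $S$ of at least three agents such that for each $d\in S$ and each $i$, $u(\vec x,X_{\pi(d)})+\epsilon\ge u(\vec x,X_i)$.
   Formalization: The k-cut $\vec x$ has rational coordinates, and its convex coefficients $\alpha_i$ and the tolerance $\epsilon$ are taken in ℚ. -}

module Defs where

open import Data.Nat as ℕ using (ℕ; zero; suc; _^_; _∸_; NonZero; >-nonZero)
open import Data.Nat.Properties using (m^n>0; *-monoʳ-≤; m<n⇒0<n∸m; m*n≢0)
open import Data.Integer using (+_)
open import Data.Rational using (ℚ; 0ℚ; _+_; _*_; _≤_; _/_)
open import Data.Fin using (Fin; zero; suc; _≟_)
open import Data.Fin.Properties using (any?)
open import Data.Fin.Subset using (Subset; _∈_; ∣_∣)
open import Data.Fin.Permutation using (Permutation′; _⟨$⟩ʳ_)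
open import Data.Vec using (tabulate)
open import Data.Product using (Σ; Σ-syntax; ∃-syntax; _×_; _,_; proj₁)
open import Relation.Binary.PropositionalEquality using (_≡_)
open import Relation.Nullary.Decidable using (⌊_⌋; yes; no)
import Data.Product

sumℕ : ∀ {m} → (Fin m → ℕ) → ℕ
sumℕ {zero}  f = 0
sumℕ {suc m} f = f zero ℕ.+ sumℕ (λ i → f (suc i))

sumℚ : ∀ {m} → (Fin m → ℚ) → ℚ
sumℚ {zero}  f = 0ℚ
sumℚ {suc m} f = f zero + sumℚ (λ i → f (suc i))

N : ℕ → ℕ
N n = 2 ^ n ∸ 1

N-nonZero′ : ∀ n → .{{NonZero n}} → NonZero (N n)
N-nonZero′ (suc m) = >-nonZero (m<n⇒0<n∸m (*-monoʳ-≤ 2 (m^n>0 2 m)))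

-- A point x with (2^n-1) x_i ∈ ℤ, x_i ≥ 0, Σ x_i = 1
-- is represented by the natural numbers a_i = N·x_i with Σ a_i = N.
-- Coordinates (= piece lengths) are indexed by Fin (suc k).

record Grid (k n : ℕ) : Set where
  constructor grid
  field
    pts    : Fin (suc k) → ℕ
    pts-Σ  : sumℕ pts ≡ N n
open Grid public

coord : ∀ {k n} .{{_ : NonZero n}} → Grid k n → Fin (suc k) → ℚ
coord {n = n} (grid a _) j = _/_ (+ a j) (N n) {{N-nonZero′ n}}

bigU : (n : ℕ) → .{{NonZero n}} → ℚ
bigU n = _/_ (+ 1) (2 ℕ.* N n) {{m*n≢0 2 (N n) {{_}} {{N-nonZero′ n}}}}

smallU : (k n : ℕ) → .{{NonZero k}} → .{{NonZero n}} → ℚ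
smallU k n = _/_ (+ 1) (10 ℕ.* k ℕ.* k ℕ.* N n)
                 {{m*n≢0 (10 ℕ.* k ℕ.* k) (N n) {{m*n≢0 (10 ℕ.* k) k {{m*n≢0 10 k}}}} {{N-nonZero′ n}}}}

uGrid : ∀ {k n} .{{_ : NonZero k}} .{{_ : NonZero n}} →
        (Grid k n → Fin (suc k)) → Grid k n → Fin (suc k) → ℚ
uGrid {k} {n} P v j with P v ≟ j
... | yes _ = bigU n
... | no  _ with pts v j
...   | zero  = 0ℚ
...   | suc _ = smallU k n

-- utility of piece X_j at x = Σ α_i x^(i) in the base simplex with corners c
uSimplex : ∀ {k n} .{{_ : NonZero k}} .{{_ : NonZero n}} →
           (Grid k n → Fin (suc k)) → (c : Fin (suc k) → Grid k n) →
           (α : Fin (suc k) → ℚ) → Fin (suc k) → ℚ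
uSimplex P c α j = sumℚ (λ i → α i * uGrid P (c i) j)

colorSet : ∀ {k n} → (Grid k n → Fin (suc k)) → (Fin (suc k) → Grid k n) →
           Subset (suc k)
colorSet P c = tabulate (λ j → ⌊ any? (λ i → P (c i) ≟ j) ⌋)

-- ε-approximate 3-out-of-m envy-free division.
-- u d j : utility of agent d for piece j (agents and pieces both Fin m).
-- π assigns piece π(d) to agent d.

ApproxEF3 : (m : ℕ) → (Fin m → Fin m → ℚ) → ℚ → Set
ApproxEF3 m u ε =
  Σ[ π ∈ Permutation′ m ] Σ[ S ∈ Subset m ]
    (3 ℕ.≤ ∣ S ∣ × (∀ d → d ∈ S → ∀ i → u d i ≤ u d (π ⟨$⟩ʳ d) + ε))

epsBound : (n : ℕ) → .{{NonZero n}} → ℚ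
epsBound n = _/_ (+ 1) (10 ℕ.* N n) {{m*n≢0 10 (N n) {{_}} {{N-nonZero′ n}}}}

{-# OPTIONS --safe #-}
-- The colours of the corners lie in a two-element set {a, b}. Every corner values the piece of
-- its own colour at 1/(2N) and utilities are convex combinations, so U(a) + U(b) ≥ 1/(2N),
-- whereas a piece j ∉ {a, b} has U(j) ≤ 1/(10k²N) ≤ 1/(10N). An agent holding such a j and
-- envying no piece by more than ε ≤ 1/(10N) would value a and b at most 2/(10N) each, and
-- 4/(10N) < 1/(2N). Hence every agent of S holds a or b, and as π is a bijection, |S| ≤ 2.
module Submission where

open import Defs
open import Algebra.Bundles using (CommutativeRing)
import Algebra.Properties.Semiring.Sum as SemiringSum
open import Data.Bool using (true; false)
open import Data.Bool.Properties using (T-≡)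
open import Data.Empty using (⊥; ⊥-elim)
open import Data.Fin using (Fin; zero; suc; _≟_)
open import Data.Fin.Permutation using (Permutation′; _⟨$⟩ʳ_; _⟨$⟩ˡ_; inverseˡ)
open import Data.Fin.Properties using (any?; all?; ¬∀⟶∃¬)
open import Data.Fin.Subset using (Subset; _∈_; _⊆_; _∪_; ⁅_⁆; ∣_∣)
open import Data.Fin.Subset.Properties
  using (∣p∣≤∣x∷p∣; p⊆q⇒∣p∣≤∣q∣; ∣⁅x⁆∣≡1; x∈⁅x⁆; x∈p∪q⁺; x∈p∧x≢y⇒x∈p-y; x∈p⇒∣p-x∣<∣p∣)
open import Data.Integer as ℤ using (+_)
import Data.Integer.Properties as ℤP
open import Data.Nat as ℕ using (ℕ; zero; suc; _≤_; NonZero; z≤n; s≤s)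
import Data.Nat.Properties as ℕP
open import Data.Product using (∃-syntax; ∃₂; _,_)
open import Data.Rational as ℚ using (ℚ; 0ℚ; 1ℚ; _+_; _*_; _/_; toℚᵘ; nonNegative)
import Data.Rational.Properties as ℚP
open import Data.Rational.Unnormalised as ℚᵘ using (mkℚᵘ; *≤*)
import Data.Rational.Unnormalised.Properties as ℚᵘP
open import Data.Sum as Sum using (_⊎_; inj₁; inj₂)
open import Data.Vec using ([]; _∷_; lookup)
open import Data.Vec.Properties using (lookup⇒[]=; lookup∘tabulate)
open import Function using (_∘_; const; Equivalence)
open import Function.Bundles using (_⇔_; mk⇔)
open import Relation.Binary.Definitions using (DecidableEquality)
open import Relation.Binary.PropositionalEquality
open import Relation.Nullary using (¬_; Dec; yes; no)
open import Relation.Nullary.Decidable using (⌊_⌋; fromWitness)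

open Equivalence using (to; from)
open SemiringSum (CommutativeRing.semiring ℚP.+-*-commutativeRing)
  using (sum; sum-cong-≗; ∑-distrib-+; *-distribʳ-sum)

sumℚ≡sum : ∀ {m} (f : Fin m → ℚ) → sumℚ f ≡ sum f
sumℚ≡sum {zero}  f = refl
sumℚ≡sum {suc m} f = cong (_+_ (f zero)) (sumℚ≡sum (f ∘ suc))

sumℚ-mono-≤ : ∀ {m} {f g : Fin m → ℚ} → (∀ i → f i ℚ.≤ g i) → sumℚ f ℚ.≤ sumℚ g
sumℚ-mono-≤ {zero}  f≤g = ℚP.≤-refl
sumℚ-mono-≤ {suc m} f≤g = ℚP.+-mono-≤ (f≤g zero) (sumℚ-mono-≤ (f≤g ∘ suc))

weightedSum : ∀ {m} → (Fin m → ℚ) → (Fin m → ℚ) → ℚ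
weightedSum α f = sumℚ (λ i → α i * f i)

module _ {m} (α : Fin m → ℚ) where

  weightedSum-mono-≤ : (∀ i → 0ℚ ℚ.≤ α i) → {f g : Fin m → ℚ} → (∀ i → f i ℚ.≤ g i) →
                       weightedSum α f ℚ.≤ weightedSum α g
  weightedSum-mono-≤ α≥0 f≤g =
    sumℚ-mono-≤ (λ i → ℚP.*-monoˡ-≤-nonNeg (α i) {{nonNegative (α≥0 i)}} (f≤g i))

  weightedSum-const : sumℚ α ≡ 1ℚ → ∀ q → weightedSum α (const q) ≡ q
  weightedSum-const Σα≡1 q = begin
    sumℚ (λ i → α i * q)  ≡⟨ sumℚ≡sum (λ i → α i * q) ⟩
    sum (λ i → α i * q)   ≡⟨ *-distribʳ-sum q α ⟨
    sum α * q             ≡⟨ cong (_* q) (trans (sym (sumℚ≡sum α)) Σα≡1) ⟩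
    1ℚ * q                ≡⟨ ℚP.*-identityˡ q ⟩
    q                     ∎
    where open ≡-Reasoning

  weightedSum-+ : ∀ f g → weightedSum α (λ i → f i + g i) ≡ weightedSum α f + weightedSum α g
  weightedSum-+ f g = begin
    sumℚ (λ i → α i * (f i + g i))
      ≡⟨ sumℚ≡sum (λ i → α i * (f i + g i)) ⟩
    sum (λ i → α i * (f i + g i))
      ≡⟨ sum-cong-≗ (λ i → ℚP.*-distribˡ-+ (α i) (f i) (g i)) ⟩
    sum (λ i → α i * f i + α i * g i)
      ≡⟨ ∑-distrib-+ (λ i → α i * f i) (λ i → α i * g i) ⟩
    sum (λ i → α i * f i) + sum (λ i → α i * g i)
      ≡⟨ cong₂ _+_ (sumℚ≡sum (λ i → α i * f i)) (sumℚ≡sum (λ i → α i * g i)) ⟨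
    weightedSum α f + weightedSum α g
      ∎
    where open ≡-Reasoning

toℚᵘ-/ : ∀ a d .{{_ : NonZero d}} → toℚᵘ (+ a / d) ℚᵘ.≃ (+ a) ℚᵘ./ d
toℚᵘ-/ a (suc d) = ℚP.toℚᵘ-fromℚᵘ (mkℚᵘ (+ a) d)

0≤/ : ∀ a d .{{_ : NonZero d}} → 0ℚ ℚ.≤ + a / d
0≤/ a d = ℚP.nonNegative⁻¹ (+ a / d) {{ℚP.normalize-nonNeg a d}}

/-≤-/⇔ : ∀ a b p q .{{_ : NonZero p}} .{{_ : NonZero q}} →
         (+ a / p ℚ.≤ + b / q) ⇔ (a ℕ.* q ≤ b ℕ.* p)
/-≤-/⇔ a b p@(suc _) q@(suc _) = mk⇔ cancel mono
  where
  pos-*′ : ∀ x y → + x ℤ.* + y ≡ + (x ℕ.* y)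
  pos-*′ x y = sym (ℤP.pos-* x y)
  cancel : + a / p ℚ.≤ + b / q → a ℕ.* q ≤ b ℕ.* p
  cancel le with ℚᵘP.≤-respʳ-≃ (toℚᵘ-/ b q) (ℚᵘP.≤-respˡ-≃ (toℚᵘ-/ a p) (ℚP.toℚᵘ-mono-≤ le))
  ... | *≤* cross = ℤP.drop‿+≤+ (subst₂ ℤ._≤_ (pos-*′ a q) (pos-*′ b p) cross)
  mono : a ℕ.* q ≤ b ℕ.* p → + a / p ℚ.≤ + b / q
  mono le = ℚP.toℚᵘ-cancel-≤
    (ℚᵘP.≤-respʳ-≃ (ℚᵘP.≃-sym (toℚᵘ-/ b q)) (ℚᵘP.≤-respˡ-≃ (ℚᵘP.≃-sym (toℚᵘ-/ a p))
      (*≤* (subst₂ ℤ._≤_ (sym (pos-*′ a q)) (sym (pos-*′ b p)) (ℤ.+≤+ le)))))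

/-+-/ : ∀ a b d .{{_ : NonZero d}} → + a / d + + b / d ≡ + (a ℕ.+ b) / d
/-+-/ a b d@(suc _) = ℚP.toℚᵘ-injective (begin
  toℚᵘ (+ a / d + + b / d)                ≈⟨ ℚP.toℚᵘ-homo-+ (+ a / d) (+ b / d) ⟩
  toℚᵘ (+ a / d) ℚᵘ.+ toℚᵘ (+ b / d)      ≈⟨ ℚᵘP.+-cong (toℚᵘ-/ a d) (toℚᵘ-/ b d) ⟩
  (+ a ℚᵘ./ d) ℚᵘ.+ (+ b ℚᵘ./ d)          ≡⟨ ℚᵘP./-cong (sym (ℤP.*-distribʳ-+ (+ d) (+ a) (+ b))) refl ⟩
  ((+ a ℤ.+ + b) ℤ.* + d) ℚᵘ./ (d ℕ.* d)  ≈⟨ ℚᵘP.*-cancelʳ-/ d ⟩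
  (+ a ℤ.+ + b) ℚᵘ./ d                    ≡⟨ ℚᵘP./-cong (sym (ℤP.pos-+ a b)) refl ⟩
  + (a ℕ.+ b) ℚᵘ./ d                      ≈⟨ ℚᵘP.≃-sym (toℚᵘ-/ (a ℕ.+ b) d) ⟩
  toℚᵘ (+ (a ℕ.+ b) / d)                  ∎)
  where open ℚᵘP.≃-Reasoning

module _ (m : ℕ) .{{_ : NonZero m}} where
  private instance
    2m≢0  : NonZero (2 ℕ.* m)
    2m≢0  = ℕP.m*n≢0 2 m
    10m≢0 : NonZero (10 ℕ.* m)
    10m≢0 = ℕP.m*n≢0 10 m

  half≰4×tenth : let tenth = + 1 / (10 ℕ.* m) in
                 ¬ (+ 1 / (2 ℕ.* m) ℚ.≤ (tenth + tenth) + (tenth + tenth))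
  half≰4×tenth le = ℕP.<⇒≱ (ℕP.n≤1+n 9) 10≤8
    where
    tenth = + 1 / (10 ℕ.* m)
    four-tenths : (tenth + tenth) + (tenth + tenth) ≡ + 4 / (10 ℕ.* m)
    four-tenths = trans (cong₂ _+_ (/-+-/ 1 1 (10 ℕ.* m)) (/-+-/ 1 1 (10 ℕ.* m))) (/-+-/ 2 2 (10 ℕ.* m))
    10m≤8m : 1 ℕ.* (10 ℕ.* m) ≤ 4 ℕ.* (2 ℕ.* m)
    10m≤8m = to (/-≤-/⇔ 1 4 (2 ℕ.* m) (10 ℕ.* m)) (subst (+ 1 / (2 ℕ.* m) ℚ.≤_) four-tenths le)
    10≤8 : 10 ≤ 8
    10≤8 = ℕP.*-cancelʳ-≤ 10 8 m (subst₂ _≤_ (ℕP.*-identityˡ (10 ℕ.* m)) (sym (ℕP.*-assoc 4 2 m)) 10m≤8m)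

∣p∪q∣≤∣p∣+∣q∣ : ∀ {m} (p q : Subset m) → ∣ p ∪ q ∣ ≤ ∣ p ∣ ℕ.+ ∣ q ∣
∣p∪q∣≤∣p∣+∣q∣ []          []         = z≤n
∣p∪q∣≤∣p∣+∣q∣ (true ∷ p)  (y ∷ q)     =
  s≤s (ℕP.≤-trans (∣p∪q∣≤∣p∣+∣q∣ p q) (ℕP.+-monoʳ-≤ ∣ p ∣ (∣p∣≤∣x∷p∣ y q)))
∣p∪q∣≤∣p∣+∣q∣ (false ∷ p) (true ∷ q)  =
  subst (suc ∣ p ∪ q ∣ ≤_) (sym (ℕP.+-suc ∣ p ∣ ∣ q ∣)) (s≤s (∣p∪q∣≤∣p∣+∣q∣ p q))
∣p∪q∣≤∣p∣+∣q∣ (false ∷ p) (false ∷ q) = ∣p∪q∣≤∣p∣+∣q∣ p q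

p⊆⁅x⁆∪⁅y⁆⇒∣p∣≤2 : ∀ {m} {p : Subset m} {x y} → p ⊆ ⁅ x ⁆ ∪ ⁅ y ⁆ → ∣ p ∣ ≤ 2
p⊆⁅x⁆∪⁅y⁆⇒∣p∣≤2 {p = p} {x} {y} p⊆x∪y = begin
  ∣ p ∣                  ≤⟨ p⊆q⇒∣p∣≤∣q∣ p⊆x∪y ⟩
  ∣ ⁅ x ⁆ ∪ ⁅ y ⁆ ∣      ≤⟨ ∣p∪q∣≤∣p∣+∣q∣ ⁅ x ⁆ ⁅ y ⁆ ⟩
  ∣ ⁅ x ⁆ ∣ ℕ.+ ∣ ⁅ y ⁆ ∣ ≡⟨ cong₂ ℕ._+_ (∣⁅x⁆∣≡1 x) (∣⁅x⁆∣≡1 y) ⟩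
  2                      ∎
  where open ℕP.≤-Reasoning

distinct∈p⇒3≤∣p∣ : ∀ {m} {p : Subset m} {x y z} → x ∈ p → y ∈ p → z ∈ p →
                   y ≢ x → z ≢ x → z ≢ y → 3 ≤ ∣ p ∣
distinct∈p⇒3≤∣p∣ x∈p y∈p z∈p y≢x z≢x z≢y =
  ℕP.≤-trans (s≤s (ℕP.≤-trans (s≤s (ℕP.≤-trans (s≤s z≤n) ∣p-x-y-z∣<∣p-x-y∣)) ∣p-x-y∣<∣p-x∣)) ∣p-x∣<∣p∣
  where
  ∣p-x∣<∣p∣         = x∈p⇒∣p-x∣<∣p∣ x∈p
  ∣p-x-y∣<∣p-x∣     = x∈p⇒∣p-x∣<∣p∣ (x∈p∧x≢y⇒x∈p-y y∈p y≢x)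
  ∣p-x-y-z∣<∣p-x-y∣ = x∈p⇒∣p-x∣<∣p∣ (x∈p∧x≢y⇒x∈p-y (x∈p∧x≢y⇒x∈p-y z∈p z≢x) z≢y)

no-three-values⇒two-values : ∀ {a m} {A : Set a} → DecidableEquality A → (f : Fin (suc m) → A) →
                             (∀ {i j l} → f j ≢ f i → f l ≢ f i → f l ≢ f j → ⊥) →
                             ∃₂ λ x y → ∀ i → f i ≡ x ⊎ f i ≡ y
no-three-values⇒two-values _≟ᴬ_ f no-three with all? (λ i → f i ≟ᴬ f zero)
... | yes constant = f zero , f zero , inj₁ ∘ constant
... | no ¬constant with ¬∀⟶∃¬ _ _ (λ i → f i ≟ᴬ f zero) ¬constant
...   | i₁ , fi₁≢f0 = f zero , f i₁ , classify
  where
  classify : ∀ i → f i ≡ f zero ⊎ f i ≡ f i₁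
  classify i with f i ≟ᴬ f zero | f i ≟ᴬ f i₁
  ... | yes fi≡f0 | _         = inj₁ fi≡f0
  ... | no _      | yes fi≡f1 = inj₂ fi≡f1
  ... | no fi≢f0  | no fi≢f1  = ⊥-elim (no-three fi₁≢f0 fi≢f0 fi≢f1)

π-into-pair⇒∣p∣≤2 : ∀ {m} (π : Permutation′ m) {p : Subset m} {a b} →
                    (∀ {d} → d ∈ p → π ⟨$⟩ʳ d ≡ a ⊎ π ⟨$⟩ʳ d ≡ b) → ∣ p ∣ ≤ 2
π-into-pair⇒∣p∣≤2 π into = p⊆⁅x⁆∪⁅y⁆⇒∣p∣≤2 (x∈p∪q⁺ ∘ Sum.map ∈⁅preimage⁆ ∈⁅preimage⁆ ∘ into)
  where
  ∈⁅preimage⁆ : ∀ {d c} → π ⟨$⟩ʳ d ≡ c → d ∈ ⁅ π ⟨$⟩ˡ c ⁆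
  ∈⁅preimage⁆ {d} refl = subst (_∈ ⁅ π ⟨$⟩ˡ (π ⟨$⟩ʳ d) ⁆) (inverseˡ π) (x∈⁅x⁆ _)

module _ {k n : ℕ} (P : Grid k n → Fin (suc k)) (c : Fin (suc k) → Grid k n) where

  ∈-colorSet : ∀ i → P (c i) ∈ colorSet P c
  ∈-colorSet i = lookup⇒[]= (P (c i)) (colorSet P c) (begin
    lookup (colorSet P c) (P (c i))  ≡⟨ lookup∘tabulate (⌊_⌋ ∘ colored?) (P (c i)) ⟩
    ⌊ colored? (P (c i)) ⌋           ≡⟨ to T-≡ (fromWitness {a? = colored? (P (c i))} (i , refl)) ⟩
    true                             ∎)
    where
    colored? : ∀ j → Dec (∃[ i ] P (c i) ≡ j)
    colored? j = any? (λ i → P (c i) ≟ j)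
    open ≡-Reasoning

  corners-two-colored : ∣ colorSet P c ∣ ≤ 2 → ∃₂ λ a b → ∀ i → P (c i) ≡ a ⊎ P (c i) ≡ b
  corners-two-colored ∣C∣≤2 = no-three-values⇒two-values _≟_ (P ∘ c) λ {i} {j} {l} fj≢fi fl≢fi fl≢fj →
    ℕP.<⇒≱ (distinct∈p⇒3≤∣p∣ (∈-colorSet i) (∈-colorSet j) (∈-colorSet l) fj≢fi fl≢fi fl≢fj) ∣C∣≤2

module _ {k n : ℕ} .{{_ : NonZero k}} .{{_ : NonZero n}} (P : Grid k n → Fin (suc k)) where
  private instance
    N≢0 : NonZero (N n)
    N≢0 = N-nonZero′ n
    2N≢0 : NonZero (2 ℕ.* N n)
    2N≢0 = ℕP.m*n≢0 2 (N n)
    10k²N≢0 : NonZero (10 ℕ.* k ℕ.* k ℕ.* N n)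
    10k²N≢0 = ℕP.m*n≢0 (10 ℕ.* k ℕ.* k) (N n) {{ℕP.m*n≢0 (10 ℕ.* k) k {{ℕP.m*n≢0 10 k}}}}
    10N≢0 : NonZero (10 ℕ.* N n)
    10N≢0 = ℕP.m*n≢0 10 (N n)

  smallU≤epsBound : smallU k n ℚ.≤ epsBound n
  smallU≤epsBound = from (/-≤-/⇔ 1 1 (10 ℕ.* k ℕ.* k ℕ.* N n) (10 ℕ.* N n))
    (ℕP.*-monoʳ-≤ 1 (ℕP.*-monoˡ-≤ (N n) (ℕP.≤-trans (ℕP.m≤m*n 10 k) (ℕP.m≤m*n (10 ℕ.* k) k))))

  uGrid-nonNeg : ∀ v j → 0ℚ ℚ.≤ uGrid P v j
  uGrid-nonNeg v j with P v ≟ j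
  ... | yes _ = 0≤/ 1 (2 ℕ.* N n)
  ... | no _ with pts v j
  ...   | zero  = ℚP.≤-refl
  ...   | suc _ = 0≤/ 1 (10 ℕ.* k ℕ.* k ℕ.* N n)

  uGrid-own : ∀ v → uGrid P v (P v) ≡ bigU n
  uGrid-own v with P v ≟ P v
  ... | yes _   = refl
  ... | no Pv≢Pv = ⊥-elim (Pv≢Pv refl)

  uGrid-other-≤ : ∀ v j → P v ≢ j → uGrid P v j ℚ.≤ smallU k n
  uGrid-other-≤ v j Pv≢j with P v ≟ j
  ... | yes Pv≡j = ⊥-elim (Pv≢j Pv≡j)
  ... | no _ with pts v j
  ...   | zero  = 0≤/ 1 (10 ℕ.* k ℕ.* k ℕ.* N n)
  ...   | suc _ = ℚP.≤-refl

  bigU≤uGrid+uGrid : ∀ v {a b} → P v ≡ a ⊎ P v ≡ b → bigU n ℚ.≤ uGrid P v a + uGrid P v b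
  bigU≤uGrid+uGrid v {b = b} (inj₁ refl) = begin
    bigU n                       ≡⟨ ℚP.+-identityʳ (bigU n) ⟨
    bigU n + 0ℚ                  ≤⟨ ℚP.+-monoʳ-≤ (bigU n) (uGrid-nonNeg v b) ⟩
    bigU n + uGrid P v b         ≡⟨ cong (_+ uGrid P v b) (uGrid-own v) ⟨
    uGrid P v (P v) + uGrid P v b ∎
    where open ℚP.≤-Reasoning
  bigU≤uGrid+uGrid v {a = a} (inj₂ refl) = begin
    bigU n                       ≡⟨ ℚP.+-identityˡ (bigU n) ⟨
    0ℚ + bigU n                  ≤⟨ ℚP.+-monoˡ-≤ (bigU n) (uGrid-nonNeg v a) ⟩
    uGrid P v a + bigU n         ≡⟨ cong (_+_ (uGrid P v a)) (uGrid-own v) ⟨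
    uGrid P v a + uGrid P v (P v) ∎
    where open ℚP.≤-Reasoning

  module _ (c : Fin (suc k) → Grid k n) (α : Fin (suc k) → ℚ)
           (α≥0 : ∀ i → 0ℚ ℚ.≤ α i) (Σα≡1 : sumℚ α ≡ 1ℚ) where
    open ℚP.≤-Reasoning

    uSimplex-uncolored-≤ : ∀ j → (∀ i → P (c i) ≢ j) → uSimplex P c α j ℚ.≤ smallU k n
    uSimplex-uncolored-≤ j uncolored = begin
      uSimplex P c α j
        ≤⟨ weightedSum-mono-≤ α α≥0 (λ i → uGrid-other-≤ (c i) j (uncolored i)) ⟩
      weightedSum α (const (smallU k n))
        ≡⟨ weightedSum-const α Σα≡1 (smallU k n) ⟩
      smallU k n
        ∎

    bigU≤uSimplex+uSimplex : ∀ {a b} → (∀ i → P (c i) ≡ a ⊎ P (c i) ≡ b) →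
                             bigU n ℚ.≤ uSimplex P c α a + uSimplex P c α b
    bigU≤uSimplex+uSimplex {a} {b} two-colored = begin
      bigU n
        ≡⟨ weightedSum-const α Σα≡1 (bigU n) ⟨
      weightedSum α (const (bigU n))
        ≤⟨ weightedSum-mono-≤ α α≥0 (λ i → bigU≤uGrid+uGrid (c i) (two-colored i)) ⟩
      weightedSum α (λ i → uGrid P (c i) a + uGrid P (c i) b)
        ≡⟨ weightedSum-+ α (λ i → uGrid P (c i) a) (λ i → uGrid P (c i) b) ⟩
      uSimplex P c α a + uSimplex P c α b
        ∎

    envy-free⇒colored-piece : ∀ {a b} → (∀ i → P (c i) ≡ a ⊎ P (c i) ≡ b) →
                              ∀ {ε j} → ε ℚ.≤ epsBound n →
                              (∀ i → uSimplex P c α i ℚ.≤ uSimplex P c α j + ε) → j ≡ a ⊎ j ≡ b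
    envy-free⇒colored-piece {a} {b} two-colored {ε} {j} ε≤e no-envy with j ≟ a | j ≟ b
    ... | yes j≡a | _       = inj₁ j≡a
    ... | no _    | yes j≡b = inj₂ j≡b
    ... | no j≢a  | no j≢b  = ⊥-elim (half≰4×tenth (N n) (begin
      bigU n                  ≤⟨ bigU≤uSimplex+uSimplex two-colored ⟩
      U a + U b               ≤⟨ ℚP.+-mono-≤ (no-envy a) (no-envy b) ⟩
      (U j + ε) + (U j + ε)   ≤⟨ ℚP.+-mono-≤ Uj+ε≤e+e Uj+ε≤e+e ⟩
      (e + e) + (e + e)       ∎))
      where
      U = uSimplex P c α
      e = epsBound n
      uncolored : ∀ i → P (c i) ≢ j
      uncolored i Pci≡j = Sum.[ j≢a ∘ trans (sym Pci≡j) , j≢b ∘ trans (sym Pci≡j) ] (two-colored i)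
      Uj+ε≤e+e : U j + ε ℚ.≤ e + e
      Uj+ε≤e+e = ℚP.+-mono-≤ (ℚP.≤-trans (uSimplex-uncolored-≤ j uncolored) smallU≤epsBound) ε≤e

lemma8p4 : (k n : ℕ) .{{_ : NonZero k}} .{{_ : NonZero n}}
    → (P : Grid k n → Fin (suc k))
    → (c : Fin (suc k) → Grid k n)
    → (α : Fin (suc k) → ℚ)
    → (∀ i → 0ℚ ℚ.≤ α i)
    → sumℚ α ≡ 1ℚ
    → (x : Fin (suc k) → ℚ)
    → (∀ j → x j ≡ sumℚ (λ i → α i ℚ.* coord (c i) j))
    → ∣ colorSet P c ∣ ≤ 2
    → (ε : ℚ)
    → ε ℚ.≤ epsBound n
    → ¬ ApproxEF3 (suc k) (λ _ j → uSimplex P c α j) ε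
lemma8p4 k n P c α α≥0 Σα≡1 _ _ ∣C∣≤2 ε ε≤e (π , S , 3≤∣S∣ , envy-free)
  with corners-two-colored P c ∣C∣≤2
... | a , b , two-colored = ℕP.<⇒≱ 3≤∣S∣ (π-into-pair⇒∣p∣≤2 π λ d∈S →
        envy-free⇒colored-piece P c α α≥0 Σα≡1 two-colored ε≤e (envy-free _ d∈S))
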